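{- Let $N$ be a labeled Petri net with places $p_1,\dots,p_n$, $C$ a Presburger formula over its places, and $\tau^*_C(\vec x,\vec x')$ a Presburger formula such that for every marking $m\models C$ and every marking $m'$, $\tau^*_C(m,m')$ holds iff $m\xRightarrow{\epsilon}m'$. Then the formula $$\forall\vec p,\vec p',a.\ C(\vec p)\wedge\overleftarrow{T}_C(\vec p,\vec p',a)\implies\exists\vec p''.\ C(\vec p'')\wedge\overleftarrow{T}_C(\vec p,\vec p'',a)\wedge\tau^*_C(\vec p'',\vec p')$$ (all variables ranging over $\mathbb N$) is valid if and only if $(N,C)$ is a coherent net.
   Context: A labeled Petri net $N=(P,T,\mathrm{Pre},\mathrm{Post})$ has finite place set $P=\{p_1,\dots,p_n\}$, finite transition set $T$, $\mathrm{Pre},\mathrm{Post}:T\to(P\to\mathbb N)$, and labeling $l:T\to\Sigma\cup\{\tau\}$ with $\tau$ the silent action. Labels are encoded as natural numbers: $\Sigma\subseteq\mathbb N\setminus\{0\}$ and $\tau$ is encoded by $0$. Markings $m:P\to\mathbb N$ are identified with vectors in $\mathbb N^n$. Transition $t$ is enabled at $m$ if $m\ge\mathrm{Pre}(t)$ componentwise, and then $m\xrightarrow{t}m'$ with $m'=m-\mathrm{Pre}(t)+\mathrm{Post}(t)$; $m\xRightarrow{\varrho}m'$ denotes firing along $\varrho\in T^*$. Extend $l$ to $T^*$ by erasing $\tau$. For $\sigma\in\Sigma^*$, $m\xRightarrow{\sigma}m'$ means some $\varrho$ with $l(\varrho)=\sigma$ has $m\xRightarrow{\varrho}m'$ (so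 $m\xRightarrow{\epsilon}m'$ means reachability by silent transitions only). $m\overset{\epsilon}{\twoheadrightarrow}m'$ iff $m'=m$; for $\sigma\in\Sigma^*$, $a\in\Sigma$, $m\overset{\sigma a}{\twoheadrightarrow}m'$ iff there exist $m''$ and $t$ with $l(t)=a$ and $m\xRightarrow{\sigma}m''\xrightarrow{t}m'$. $(N,C)$ is a coherent net if for every $m\models C$, every $\sigma\in\Sigma^*$ and every $m'$ with $m\xRightarrow{\sigma}m'$, there is $m''\models C$ with $m\overset{\sigma}{\twoheadrightarrow}m''$ and $m''\xRightarrow{\epsilon}m'$. Formulas: $\mathrm{ENBL}_t(\vec x)\triangleq\bigwedge_i x_i\ge\mathrm{Pre}(t,p_i)$; $\Delta_t(\vec x,\vec x')\triangleq\bigwedge_i x_i'=x_i+\mathrm{Post}(t,p_i)-\mathrm{Pre}(t,p_i)$; $T(\vec x,\vec x',a)\triangleq\bigvee_{t\in T,\ l(t)\neq\tau}(\mathrm{ENBL}_t(\vec x)\wedge\Delta_t(\vec x,\vec x')\wedge a=l(t))$, so that $T(m,m',a)$ holds iff $m\xrightarrow{t}m'$ for some $t$ with $l(t)=a\in\Sigma$; and $\overleftarrow{T}_C(\vec x,\vec x',a)\triangleq\exists\vec x''.\ \tau^*_C(\vec x,\vec x'')\wedge T(\vec x'',\vec x',a)$. -}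

module Defs where

open import Data.Nat using (ℕ; zero; suc; _+_; _∸_; _≤_)
open import Data.Fin using (Fin)
open import Data.Vec using (Vec; []; _∷_; _++_; lookup)
open import Data.List using (List; []; _∷_; _∷ʳ_)
open import Data.List.Relation.Unary.All using (All)
open import Data.Product using (Σ; ∃; _×_)
open import Data.Sum using (_⊎_)
open import Data.Empty using (⊥)
open import Relation.Nullary using (¬_)
open import Relation.Binary.PropositionalEquality using (_≡_; _≢_)
open import Function.Bundles using (_⇔_)

data Term (k : ℕ) : Set where
  const : ℕ → Term k
  var   : Fin k → Term k
  _⊕_   : Term k → Term k → Term k

data Formula (k : ℕ) : Set where
  _≐_  : Term k → Term k → Formula k
  _≦_  : Term k → Term k → Formula k
  ~_   : Formula k → Formula k
  _∧_  : Formula k → Formula k → Formula k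
  _∨_  : Formula k → Formula k → Formula k
  all  : Formula (suc k) → Formula k   -- binds variable 0
  ex   : Formula (suc k) → Formula k   -- binds variable 0

evalT : ∀ {k} → Term k → Vec ℕ k → ℕ
evalT (const c) ρ = c
evalT (var i)   ρ = lookup ρ i
evalT (s ⊕ t)   ρ = evalT s ρ + evalT t ρ

_⊨_ : ∀ {k} → Vec ℕ k → Formula k → Set
ρ ⊨ (s ≐ t) = evalT s ρ ≡ evalT t ρ
ρ ⊨ (s ≦ t) = evalT s ρ ≤ evalT t ρ
ρ ⊨ (~ φ)   = ¬ (ρ ⊨ φ)
ρ ⊨ (φ ∧ ψ) = (ρ ⊨ φ) × (ρ ⊨ ψ)
ρ ⊨ (φ ∨ ψ) = (ρ ⊨ φ) ⊎ (ρ ⊨ ψ)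
ρ ⊨ all φ   = (x : ℕ) → (x ∷ ρ) ⊨ φ
ρ ⊨ ex φ    = Σ ℕ (λ x → (x ∷ ρ) ⊨ φ)

-- Labeled Petri nets with n places p_1..p_n (indexed by Fin n).
-- Transitions: Fin nT. Labels are naturals, 0 encodes τ.

record Net (n : ℕ) : Set where
  field
    nT    : ℕ
    Pre   : Fin nT → Vec ℕ n
    Post  : Fin nT → Vec ℕ n
    label : Fin nT → ℕ

Marking : ℕ → Set
Marking n = Vec ℕ n

module _ {n : ℕ} (N : Net n) where
  open Net N

  Enabled : Fin nT → Marking n → Set
  Enabled t m = ∀ i → lookup (Pre t) i ≤ lookup m i

  Step : Marking n → Fin nT → Marking n → Set
  Step m t m' = Enabled t m × (∀ i → lookup m' i ≡ lookup m i ∸ lookup (Pre t) i + lookup (Post t) i)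

  data Fires : Marking n → List (Fin nT) → Marking n → Set where
    fnil  : ∀ {m} → Fires m [] m
    fcons : ∀ {m m₁ m' t ρ} → Step m t m₁ → Fires m₁ ρ m' → Fires m (t ∷ ρ) m'

  lab : List (Fin nT) → List ℕ
  lab [] = []
  lab (t ∷ ρ) with label t
  ... | zero  = lab ρ
  ... | suc a = suc a ∷ lab ρ

  WReach : Marking n → List ℕ → Marking n → Set
  WReach m σ m' = Σ (List (Fin nT)) (λ ρ → lab ρ ≡ σ × Fires m ρ m')

  data Ends : Marking n → List ℕ → Marking n → Set where
    eps  : ∀ {m} → Ends m [] m
    snoc : ∀ {m m'' m' σ a} (t : Fin nT) → WReach m σ m'' → Step m'' t m' →
           label t ≡ a → Ends m (σ ∷ʳ a) m'

  Word : List ℕ → Set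
  Word σ = All (λ a → a ≢ 0) σ

  Coherent : Formula n → Set
  Coherent C = ∀ (m : Marking n) → m ⊨ C → ∀ (σ : List ℕ) → Word σ →
    ∀ (m' : Marking n) → WReach m σ m' →
    Σ (Marking n) (λ m'' → (m'' ⊨ C) × Ends m σ m'' × WReach m'' [] m')

  -- semantic reading of the formulas ENBL_t, Δ_t, T, ←T_C
  ENBL : Fin nT → Vec ℕ n → Set
  ENBL t x = ∀ i → lookup x i ≥' lookup (Pre t) i
    where
      _≥'_ : ℕ → ℕ → Set
      a ≥' b = b ≤ a

  Δ : Fin nT → Vec ℕ n → Vec ℕ n → Set
  Δ t x x' = ∀ i → lookup x' i + lookup (Pre t) i ≡ lookup x i + lookup (Post t) i

  TF : Vec ℕ n → Vec ℕ n → ℕ → Set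
  TF x x' a = Σ (Fin nT) (λ t → label t ≢ 0 × ENBL t x × Δ t x x' × a ≡ label t)

  TC : Formula (n + n) → Vec ℕ n → Vec ℕ n → ℕ → Set
  TC τC x x' a = Σ (Vec ℕ n) (λ x'' → ((x ++ x'') ⊨ τC) × TF x'' x' a)

  ValidFormula : Formula n → Formula (n + n) → Set
  ValidFormula C τC = ∀ (p p' : Vec ℕ n) (a : ℕ) → p ⊨ C → TC τC p p' a →
    Σ (Vec ℕ n) (λ p'' → (p'' ⊨ C) × TC τC p p'' a × ((p'' ++ p') ⊨ τC))

  CapturesSilent : Formula n → Formula (n + n) → Set
  CapturesSilent C τC = ∀ (m m' : Marking n) → m ⊨ C → (((m ++ m') ⊨ τC) ⇔ WReach m [] m')

-- For p ⊨ C the hypothesis on τ*_C makes ←T_C(p, p', a) say exactly p --a-->> p', so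
-- validity of the formula is coherence for one-letter words. Coherence for arbitrary words
-- follows by walking along a firing sequence and applying validity at each visible
-- transition, which restarts the walk from a marking satisfying C.
module Submission where

open import Defs
open import Data.Nat using (ℕ; zero; suc; _+_; _∸_; _≤_)
open import Data.Nat.Properties using (m∸n+n≡m; +-cancelʳ-≡; +-assoc; +-comm; 1+n≢0)
open import Data.Fin using (Fin)
open import Data.Vec using (lookup) renaming (_++_ to _++ᵛ_)
open import Data.List using ([]; _∷_; _++_)
open import Data.List.Relation.Unary.All using ([]; _∷_)
open import Data.Product using (Σ; _×_; _,_)
open import Data.Empty using (⊥-elim)
open import Relation.Binary.PropositionalEquality
open import Function using (_∘_)
open import Function.Bundles using (_⇔_; mk⇔; Equivalence)

-- Translates the effect of a step between the truncated subtraction of Step and the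
-- subtraction-free form of Δ.
∸-+-+-cancel : ∀ {a b} c → b ≤ a → a ∸ b + c + b ≡ a + c
∸-+-+-cancel {a} {b} c b≤a = begin
  a ∸ b + c + b   ≡⟨ +-assoc (a ∸ b) c b ⟩
  a ∸ b + (c + b) ≡⟨ cong (a ∸ b +_) (+-comm c b) ⟩
  a ∸ b + (b + c) ≡⟨ +-assoc (a ∸ b) b c ⟨
  a ∸ b + b + c   ≡⟨ cong (_+ c) (m∸n+n≡m b≤a) ⟩
  a + c           ∎
  where open ≡-Reasoning

module _ {n : ℕ} (N : Net n) where
  open Net N

  step⇒ENBL×Δ : ∀ {m t m'} → Step N m t m' → ENBL N t m × Δ N t m m'
  step⇒ENBL×Δ {m} {t} (enabled , next) =
    enabled , λ i → trans (cong (_+ lookup (Pre t) i) (next i))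
                          (∸-+-+-cancel (lookup (Post t) i) (enabled i))

  ENBL×Δ⇒step : ∀ {m t m'} → ENBL N t m → Δ N t m m' → Step N m t m'
  ENBL×Δ⇒step {m} {t} enabled δ =
    enabled , λ i → +-cancelʳ-≡ (lookup (Pre t) i) _ _
                      (trans (δ i) (sym (∸-+-+-cancel (lookup (Post t) i) (enabled i))))

  Fires-++ : ∀ {m k m' ρ₁ ρ₂} → Fires N m ρ₁ k → Fires N k ρ₂ m' → Fires N m (ρ₁ ++ ρ₂) m'
  Fires-++ fnil        g = g
  Fires-++ (fcons s f) g = fcons s (Fires-++ f g)

  lab-++ : ∀ ρ₁ ρ₂ → lab N (ρ₁ ++ ρ₂) ≡ lab N ρ₁ ++ lab N ρ₂
  lab-++ []       ρ₂ = refl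
  lab-++ (t ∷ ρ₁) ρ₂ with label t
  ... | zero  = lab-++ ρ₁ ρ₂
  ... | suc a = cong (suc a ∷_) (lab-++ ρ₁ ρ₂)

  lab-silent : ∀ {t} → label t ≡ 0 → lab N (t ∷ []) ≡ []
  lab-silent {t} eq with label t
  lab-silent refl | .zero = refl

  lab-visible : ∀ {t} → label t ≢ 0 → lab N (t ∷ []) ≡ label t ∷ []
  lab-visible {t} visible with label t
  ... | zero  = ⊥-elim (visible refl)
  ... | suc a = refl

  WReach-++ : ∀ {m k m' σ σ'} → WReach N m σ k → WReach N k σ' m' → WReach N m (σ ++ σ') m'
  WReach-++ (ρ₁ , refl , f₁) (ρ₂ , refl , f₂) = ρ₁ ++ ρ₂ , lab-++ ρ₁ ρ₂ , Fires-++ f₁ f₂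

  step⇒WReach : ∀ {m t m'} → Step N m t m' → WReach N m (lab N (t ∷ [])) m'
  step⇒WReach {t = t} s = t ∷ [] , refl , fcons s fnil

  Visible : Marking n → ℕ → Marking n → Set
  Visible m a m' = Σ (Marking n) λ x → WReach N m [] x ×
                   Σ (Fin nT) λ t → label t ≢ 0 × Step N x t m' × a ≡ label t

  Visible⇒≢0 : ∀ {m a m'} → Visible m a m' → a ≢ 0
  Visible⇒≢0 (_ , _ , _ , visible , _ , refl) = visible

  Visible⇒WReach : ∀ {m a m'} → Visible m a m' → WReach N m (a ∷ []) m'
  Visible⇒WReach {m} {m' = m'} (x , w , t , visible , s , refl) =
    subst (λ σ → WReach N m σ m') (lab-visible visible) (WReach-++ w (step⇒WReach {x} {t} {m'} s))

  Visible⇒Ends : ∀ {m a m'} → Visible m a m' → Ends N m (a ∷ []) m'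
  Visible⇒Ends (_ , w , t , _ , s , a≡lt) = snoc t w s (sym a≡lt)

  Ends⇒Visible : ∀ {m a m'} → a ≢ 0 → Ends N m (a ∷ []) m' → Visible m a m'
  Ends⇒Visible {a = a} a≢0 e = invert e refl
    where
    invert : ∀ {m σ m'} → Ends N m σ m' → σ ≡ a ∷ [] → Visible m a m'
    invert eps ()
    invert (snoc {σ = []} t w s refl) refl = _ , w , t , a≢0 , s , refl
    invert (snoc {σ = _ ∷ []}    _ _ _ _) ()
    invert (snoc {σ = _ ∷ _ ∷ _} _ _ _ _) ()

  Ends-cons : ∀ {k a p σ m} → Visible k a p → Ends N p σ m → Ends N k (a ∷ σ) m
  Ends-cons v eps             = Visible⇒Ends v
  Ends-cons v (snoc t w s lt) = snoc t (WReach-++ (Visible⇒WReach v) w) s lt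

  module _ (C : Formula n) (τC : Formula (n + n)) (captures : CapturesSilent N C τC) where

    silent⇒τC : ∀ {m m'} → m ⊨ C → WReach N m [] m' → (m ++ᵛ m') ⊨ τC
    silent⇒τC {m} {m'} c = Equivalence.from (captures m m' c)

    τC⇒silent : ∀ {m m'} → m ⊨ C → (m ++ᵛ m') ⊨ τC → WReach N m [] m'
    τC⇒silent {m} {m'} c = Equivalence.to (captures m m' c)

    TC⇒Visible : ∀ {p p' a} → p ⊨ C → TC N τC p p' a → Visible p a p'
    TC⇒Visible {p} {p'} c (x , τ , t , visible , enabled , δ , a≡lt) =
      x , τC⇒silent {p} {x} c τ , t , visible , ENBL×Δ⇒step {x} {t} {p'} enabled δ , a≡lt

    Visible⇒TC : ∀ {p p' a} → p ⊨ C → Visible p a p' → TC N τC p p' a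
    Visible⇒TC {p' = p'} c (x , w , t , visible , s , a≡lt) =
      let enabled , δ = step⇒ENBL×Δ {x} {t} {p'} s in x , silent⇒τC c w , t , visible , enabled , δ , a≡lt

    coherent⇒valid : Coherent N C → ValidFormula N C τC
    coherent⇒valid coherent p p' a c tc = pushBack
      (coherent p c (a ∷ []) (a≢0 ∷ []) p' (Visible⇒WReach v))
      where
      v : Visible p a p'
      v = TC⇒Visible {p} {p'} c tc
      a≢0 : a ≢ 0
      a≢0 = Visible⇒≢0 {p} {a} {p'} v
      pushBack : Σ (Marking n) (λ m'' → (m'' ⊨ C) × Ends N p (a ∷ []) m'' × WReach N m'' [] p') →
                 Σ (Marking n) (λ p'' → (p'' ⊨ C) × TC N τC p p'' a × ((p'' ++ᵛ p') ⊨ τC))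
      pushBack (p'' , c'' , ends , w) =
        p'' , c'' , Visible⇒TC {p} {p''} c (Ends⇒Visible a≢0 ends) , silent⇒τC {p''} {p'} c'' w

    -- Induction along the firing sequence: silent transitions are absorbed into the
    -- trailing ε-run, and each visible one is pushed back to a C-marking by validity.
    valid⇒coherent-from : ValidFormula N C τC → ∀ ρ {k m m'} → k ⊨ C → WReach N k [] m →
      Fires N m ρ m' → Σ (Marking n) λ m'' → (m'' ⊨ C) × Ends N k (lab N ρ) m'' × WReach N m'' [] m'
    valid⇒coherent-from valid []      {k} c w fnil = k , c , eps , w
    valid⇒coherent-from valid (t ∷ ρ) {k} {m} c w (fcons {m₁ = m₁} s f) with label t in lt
    ... | zero  = valid⇒coherent-from valid ρ c
                    (subst (λ σ → WReach N k σ m₁) (lab-silent lt) (WReach-++ w (step⇒WReach {m} {t} {m₁} s))) f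
    ... | suc b with valid k m₁ (suc b) c (Visible⇒TC {k} {m₁} c (m , w , t , 1+n≢0 ∘ trans (sym lt) , s , sym lt))
    ...   | p'' , c'' , tc , τ with valid⇒coherent-from valid ρ c'' (τC⇒silent {p''} {m₁} c'' τ) f
    ...     | m'' , c''' , ends , w' = m'' , c''' , Ends-cons (TC⇒Visible {k} {p''} c tc) ends , w'

    valid⇒coherent : ValidFormula N C τC → Coherent N C
    valid⇒coherent valid m c σ _ m' (ρ , refl , f) =
      valid⇒coherent-from valid ρ c ([] , refl , fnil) f

lemma4 : ∀ {n : ℕ} (N : Net n) (C : Formula n) (τC : Formula (n + n)) →
         CapturesSilent N C τC →
         (ValidFormula N C τC ⇔ Coherent N C)
lemma4 N C τC captures = mk⇔ (valid⇒coherent N C τC captures) (coherent⇒valid N C τC captures)
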